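{- Let $q$ be a prime power, $n\geq1$, and let $M\in\mathrm{GL}_{n+1}(\mathbb{F}_q)$ be such that $\Psi=[M]\in\mathrm{PGL}_{n+1}(\mathbb{F}_q)$ acts transitively on $\mathbb{P}^n(\mathbb{F}_q)$. For $i\in\{1,\dots,n+1\}$ write $M^i=(m^{(i)}_{h,k})_{h,k}$ and let $b^{(i)}=m^{(i)}_{n+1,n+1}+\sum_{k=1}^n m^{(i)}_{n+1,k}x_k\in\mathbb{F}_q[x_1,\dots,x_n]$. Then $b^{(1)}\neq 0$, and for every $i\in\{2,\dots,n+1\}$ the polynomial $b^{(i)}$ does not lie in the ideal of $\mathbb{F}_q[x_1,\dots,x_n]$ generated by $b^{(1)},\dots,b^{(i-1)}$.
   Context: $\Psi$ is transitive if it has a single orbit on $\mathbb{P}^n(\mathbb{F}_q)$. The polynomial $b^{(i)}$ is the common denominator of the dehomogenization of $M^i$, i.e. of the map $x\mapsto$ (first $n$ coordinates of $M^i(x_1,\dots,x_n,1)^T$) divided by its last coordinate. -}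

module Defs where

open import Level using (Level; _⊔_)
open import Data.Nat using (ℕ; zero; suc; _≤_; _<_)
open import Data.Fin using (Fin; fromℕ; inject₁; toℕ; fromℕ<)
open import Data.Fin as F using ()
open import Data.Vec using (Vec; replicate; _[_]≔_; zipWith)
open import Data.List using (allFin)
import Data.Nat as N
open import Data.Vec.Properties using (≡-dec)
open import Data.Nat.Properties using () renaming (_≟_ to _≟ℕ_)
open import Data.List using (List; []; _∷_; map; concatMap; foldr; _++_)
open import Data.List.Relation.Unary.Any using (Any)
open import Data.Product using (Σ; ∃; ∃-syntax; _×_; _,_; proj₁; proj₂)
open import Relation.Nullary using (¬_; yes; no)
open import Relation.Binary.PropositionalEquality using (_≡_)
open import Algebra.Bundles using (CommutativeRing)

record IsFieldRing {c ℓ} (R : CommutativeRing c ℓ) : Set (c ⊔ ℓ) where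
  open CommutativeRing R
  field
    1≉0 : ¬ (1# ≈ 0#)
    inverse : ∀ x → ¬ (x ≈ 0#) → ∃[ y ] (x * y ≈ 1#)

-- A finite field: a field together with a finite list enumerating all its
-- elements (up to the setoid equality).  Its cardinality q is then
-- automatically a prime power.
record FiniteField c ℓ : Set (Level.suc (c ⊔ ℓ)) where
  field
    baseRing : CommutativeRing c ℓ
    isField : IsFieldRing baseRing
  open CommutativeRing baseRing public
  field
    elements : List Carrier
    complete : ∀ x → Any (x ≈_) elements

module FF {c ℓ} (K : FiniteField c ℓ) where
  open FiniteField K

  Mat : ℕ → Set c
  Mat m = Fin m → Fin m → Carrier

  sumFin : ∀ {m} → (Fin m → Carrier) → Carrier
  sumFin {zero} f = 0#
  sumFin {suc m} f = f F.zero + sumFin (λ i → f (F.suc i))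

  _⊗_ : ∀ {m} → Mat m → Mat m → Mat m
  (A ⊗ B) h k = sumFin (λ j → A h j * B j k)

  idMat : ∀ {m} → Mat m
  idMat h k with toℕ h ≟ℕ toℕ k
  ... | yes _ = 1#
  ... | no _ = 0#

  _^_ : ∀ {m} → Mat m → ℕ → Mat m
  A ^ zero = idMat
  A ^ suc i = A ⊗ (A ^ i)

  _≈M_ : ∀ {m} → Mat m → Mat m → Set ℓ
  A ≈M B = ∀ h k → A h k ≈ B h k

  Invertible : ∀ {m} → Mat m → Set (c ⊔ ℓ)
  Invertible A = ∃[ B ] ((A ⊗ B) ≈M idMat × (B ⊗ A) ≈M idMat)

  -- Projective space P^n(K): nonzero vectors of K^(n+1) up to scalars

  Vect : ℕ → Set c
  Vect m = Fin m → Carrier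

  NonZeroV : ∀ {m} → Vect m → Set ℓ
  NonZeroV v = ¬ (∀ k → v k ≈ 0#)

  apply : ∀ {m} → Mat m → Vect m → Vect m
  apply A v h = sumFin (λ k → A h k * v k)

  SamePoint : ∀ {m} → Vect m → Vect m → Set (c ⊔ ℓ)
  SamePoint u v = ∃[ λ′ ] (¬ (λ′ ≈ 0#) × (∀ k → u k ≈ λ′ * v k))

  TransitiveOnP : ∀ {m} → Mat m → Set (c ⊔ ℓ)
  TransitiveOnP A =
    ∀ u v → NonZeroV u → NonZeroV v → ∃[ i ] SamePoint (apply (A ^ i) u) v

  -- Polynomials in K[x_1,…,x_n]: finite lists of terms (coefficient,
  -- exponent vector); two polynomials are equal iff they have the same
  -- coefficient on every monomial.

  Poly : ℕ → Set c
  Poly n = List (Carrier × Vec ℕ n)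

  coeff : ∀ {n} → Poly n → Vec ℕ n → Carrier
  coeff [] e = 0#
  coeff ((a , e′) ∷ p) e with ≡-dec _≟ℕ_ e′ e
  ... | yes _ = a + coeff p e
  ... | no _ = coeff p e

  _≈P_ : ∀ {n} → Poly n → Poly n → Set ℓ
  p ≈P r = ∀ e → coeff p e ≈ coeff r e

  zeroP : ∀ {n} → Poly n
  zeroP = []

  _+P_ : ∀ {n} → Poly n → Poly n → Poly n
  p +P r = p ++ r

  addExp : ∀ {n} → Vec ℕ n → Vec ℕ n → Vec ℕ n
  addExp = zipWith N._+_

  _*P_ : ∀ {n} → Poly n → Poly n → Poly n
  p *P r = concatMap (λ { (a , e) → map (λ { (b , e′) → (a * b , addExp e e′) }) r }) p

  sumP : ∀ {n k} → (Fin k → Poly n) → Poly n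
  sumP {k = zero} f = zeroP
  sumP {k = suc k} f = f F.zero +P sumP (λ j → f (F.suc j))

  InIdeal : ∀ {n k} → Poly n → (Fin k → Poly n) → Set (c ⊔ ℓ)
  InIdeal {n} {k} p g = Σ (Fin k → Poly n) λ a → (p ≈P sumP (λ j → a j *P g j))

  unitExp : ∀ {n} → Fin n → Vec ℕ n
  unitExp {n} k = replicate n 0 [ k ]≔ 1

  bPoly : ∀ {n} → Mat (suc n) → ℕ → Poly n
  bPoly {n} A i =
    (Mi (fromℕ n) (fromℕ n) , replicate n 0)
      ∷ map (λ k → (Mi (fromℕ n) (inject₁ k) , unitExp k)) (allFin n)
    where Mi = A ^ i

{-# OPTIONS --safe #-}
-- The polynomial b⁽ʲ⁾ is the dehomogenisation of the linear form v ↦ (Mʲ v)ₙ₊₁, so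
-- b⁽ⁱ⁾ ∈ (b⁽¹⁾, …, b⁽ⁱ⁻¹⁾) makes the i-th form vanish at every affine vector (vₙ₊₁ ≠ 0) of the
-- common kernel W of the forms 1, …, i − 1.  W is nonzero, being cut out by i − 1 < n + 1
-- equations.  If W contains an affine vector u, every vertical v ∈ W is the difference of the
-- affine vectors v + u and u, so the i-th form vanishes on all of W and W is M-invariant;
-- otherwise the 0-th form vanishes on W and W is M⁻¹-invariant.  Both M and M⁻¹ act
-- transitively, so either way W contains every nonzero vector, which fails for M⁻ⁱ eₙ₊₁,
-- resp. eₙ₊₁.  Equality in K is not assumed decidable, so every case distinction is made
-- under double negation.
module Submission where

open import Defs
open import Level using (_⊔_)
open import Data.Nat using (ℕ; suc; _≤_; _∸_)
open import Data.Fin using (Fin; toℕ)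
open import Data.Product using (_×_)
open import Relation.Nullary using (¬_)

import Data.Nat as ℕ
import Data.Nat.Properties as ℕ
import Data.Fin as F
import Data.Fin.Properties as F
open import Data.Vec as V using (Vec; []; _∷_)
open import Data.Vec.Properties using (≡-dec)
open import Data.Vec.Functional using (insertAt)
open import Data.Vec.Functional.Properties using (insertAt-lookup; insertAt-punchIn)
import Data.List as L
open import Data.List.Properties using (map-tabulate)
open import Data.List.Membership.Propositional using (_∈_)
open import Data.List.Membership.Propositional.Properties
  using (∈-++⁺ˡ; ∈-++⁺ʳ; ∈-deduplicate⁺)
open import Data.List.Relation.Unary.All as All using (All)
open import Data.List.Relation.Unary.Any using (here; there)
open import Data.List.Relation.Unary.Unique.Propositional using (Unique; []; _∷_)
open import Data.List.Relation.Unary.Unique.DecPropositional.Properties using (deduplicate-!)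
open import Data.Product using (∃; ∃-syntax; _,_; proj₂)
open import Data.Empty using (⊥; ⊥-elim)
open import Data.Sum using (inj₁; inj₂)
open import Function using (_∘_)
open import Relation.Nullary using (Dec; yes; no)
open import Relation.Nullary.Negation using (DoubleNegation; ¬¬-map; contradiction)
open import Relation.Nullary.Decidable using (¬¬-excluded-middle)
open import Relation.Binary.PropositionalEquality as ≡ using (_≡_; _≢_)

¬¬-∀Fin : ∀ {p k} {P : Fin k → Set p} →
  (∀ j → DoubleNegation (P j)) → DoubleNegation (∀ j → P j)
¬¬-∀Fin {k = ℕ.zero} _ ¬∀P = ¬∀P (λ ())
¬¬-∀Fin {k = suc k} ¬¬P ¬∀P = ¬¬P F.zero λ P₀ → ¬¬-∀Fin (¬¬P ∘ F.suc) λ P₊ →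
  ¬∀P λ { F.zero → P₀ ; (F.suc j) → P₊ j }

module Development {c ℓ} (K : FiniteField c ℓ) where
  open FiniteField K
  open FF K
  open IsFieldRing isField
  open import Relation.Binary.Reasoning.Setoid setoid
  open import Algebra.Properties.Semiring.Sum semiring
    using (sum; sum-cong-≋; sum-replicate-zero; ∑-distrib-+; ∑-comm; sum-remove; sum-init-last;
           *-distribˡ-sum; *-distribʳ-sum)
  open import Algebra.Properties.Semiring.Exp semiring
    using () renaming (_^_ to _^ᶜ_; ^-homo-* to ^ᶜ-homo-*)
  open import Algebra.Properties.Ring ring using (-1*x≈-x; -‿distribˡ-*; -‿distribʳ-*)
  open import Algebra.Properties.CommutativeSemigroup *-commutativeSemigroup
    using (interchange; x∙yz≈y∙xz)
  open import Algebra.Properties.CommutativeSemigroup +-commutativeSemigroup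
    using () renaming (interchange to +-interchange)

  *-zeroʳ-≈ : ∀ x {y} → y ≈ 0# → x * y ≈ 0#
  *-zeroʳ-≈ x y≈0 = trans (*-congˡ y≈0) (zeroʳ x)

  *-zeroˡ-≈ : ∀ {x} y → x ≈ 0# → x * y ≈ 0#
  *-zeroˡ-≈ y x≈0 = trans (*-congʳ x≈0) (zeroˡ y)

  inverse-cancel : ∀ {a b} → a * b ≈ 1# → ∀ x → b * (a * x) ≈ x
  inverse-cancel {a} {b} ab≈1 x = begin
    b * (a * x) ≈⟨ *-assoc b a x ⟨
    b * a * x   ≈⟨ *-congʳ (trans (*-comm b a) ab≈1) ⟩
    1# * x      ≈⟨ *-identityˡ x ⟩
    x           ∎

  inverse-nonzero : ∀ {a b} → a * b ≈ 1# → ¬ b ≈ 0#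
  inverse-nonzero {a} ab≈1 b≈0 = 1≉0 (trans (sym ab≈1) (*-zeroʳ-≈ a b≈0))

  nonzero⇒¬¬pivot : ∀ {k} {v : Vect k} → NonZeroV v → DoubleNegation (∃ λ p → ¬ v p ≈ 0#)
  nonzero⇒¬¬pivot v≢0 ¬pivot = ¬¬-∀Fin (λ p vp≢0 → ¬pivot (p , vp≢0)) v≢0

  sumFin≡sum : ∀ {m} (f : Fin m → Carrier) → sumFin f ≡ sum f
  sumFin≡sum {ℕ.zero} f = ≡.refl
  sumFin≡sum {suc m} f = ≡.cong (f F.zero +_) (sumFin≡sum (f ∘ F.suc))

  sumFin-cong : ∀ {m} {f g : Fin m → Carrier} → (∀ i → f i ≈ g i) → sumFin f ≈ sumFin g
  sumFin-cong {f = f} {g} f≈g = begin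
    sumFin f ≡⟨ sumFin≡sum f ⟩
    sum f    ≈⟨ sum-cong-≋ f≈g ⟩
    sum g    ≡⟨ sumFin≡sum g ⟨
    sumFin g ∎

  sumFin-zero : ∀ {m} {f : Fin m → Carrier} → (∀ i → f i ≈ 0#) → sumFin f ≈ 0#
  sumFin-zero {m} {f} f≈0 = begin
    sumFin f              ≈⟨ sumFin-cong f≈0 ⟩
    sumFin {m} (λ _ → 0#) ≡⟨ sumFin≡sum {m} (λ _ → 0#) ⟩
    sum {m} (λ _ → 0#)    ≈⟨ sum-replicate-zero m ⟩
    0#                    ∎

  sumFin-+ : ∀ {m} (f g : Fin m → Carrier) → sumFin (λ i → f i + g i) ≈ sumFin f + sumFin g
  sumFin-+ f g = begin
    sumFin (λ i → f i + g i) ≡⟨ sumFin≡sum (λ i → f i + g i) ⟩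
    sum (λ i → f i + g i)    ≈⟨ ∑-distrib-+ f g ⟩
    sum f + sum g            ≡⟨ ≡.cong₂ _+_ (sumFin≡sum f) (sumFin≡sum g) ⟨
    sumFin f + sumFin g      ∎

  *-distribˡ-sumFin : ∀ {m} a (f : Fin m → Carrier) → a * sumFin f ≈ sumFin (λ i → a * f i)
  *-distribˡ-sumFin a f = begin
    a * sumFin f           ≡⟨ ≡.cong (a *_) (sumFin≡sum f) ⟩
    a * sum f              ≈⟨ *-distribˡ-sum a f ⟩
    sum (λ i → a * f i)    ≡⟨ sumFin≡sum (λ i → a * f i) ⟨
    sumFin (λ i → a * f i) ∎

  *-distribʳ-sumFin : ∀ {m} a (f : Fin m → Carrier) → sumFin f * a ≈ sumFin (λ i → f i * a)
  *-distribʳ-sumFin a f = begin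
    sumFin f * a           ≡⟨ ≡.cong (_* a) (sumFin≡sum f) ⟩
    sum f * a              ≈⟨ *-distribʳ-sum a f ⟩
    sum (λ i → f i * a)    ≡⟨ sumFin≡sum (λ i → f i * a) ⟨
    sumFin (λ i → f i * a) ∎

  sumFin-comm : ∀ {m k} (f : Fin m → Fin k → Carrier) →
    sumFin (λ i → sumFin (f i)) ≈ sumFin (λ j → sumFin (λ i → f i j))
  sumFin-comm f = begin
    sumFin (λ i → sumFin (f i))
      ≈⟨ sumFin-cong (λ i → reflexive (sumFin≡sum (f i))) ⟩
    sumFin (λ i → sum (f i))
      ≡⟨ sumFin≡sum (λ i → sum (f i)) ⟩
    sum (λ i → sum (f i))
      ≈⟨ ∑-comm f ⟩
    sum (λ j → sum (λ i → f i j))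
      ≡⟨ sumFin≡sum (λ j → sum (λ i → f i j)) ⟨
    sumFin (λ j → sum (λ i → f i j))
      ≈⟨ sumFin-cong (λ j → reflexive (sumFin≡sum (λ i → f i j))) ⟨
    sumFin (λ j → sumFin (λ i → f i j)) ∎

  sumFin-remove : ∀ {m} (f : Fin (suc m) → Carrier) p →
    sumFin f ≈ f p + sumFin (f ∘ F.punchIn p)
  sumFin-remove f p = begin
    sumFin f                       ≡⟨ sumFin≡sum f ⟩
    sum f                          ≈⟨ sum-remove f ⟩
    f p + sum (f ∘ F.punchIn p)    ≡⟨ ≡.cong (f p +_) (sumFin≡sum (f ∘ F.punchIn p)) ⟨
    f p + sumFin (f ∘ F.punchIn p) ∎

  sumFin-init-last : ∀ {m} (f : Fin (suc m) → Carrier) →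
    sumFin f ≈ sumFin (f ∘ F.inject₁) + f (F.fromℕ m)
  sumFin-init-last {m} f = begin
    sumFin f                            ≡⟨ sumFin≡sum f ⟩
    sum f                               ≈⟨ sum-init-last f ⟩
    sum (f ∘ F.inject₁) + f (F.fromℕ m) ≡⟨ ≡.cong (_+ f (F.fromℕ m)) (sumFin≡sum (f ∘ F.inject₁)) ⟨
    sumFin (f ∘ F.inject₁) + f (F.fromℕ m) ∎

  dot : ∀ {m} → Vect m → Vect m → Carrier
  dot u v = sumFin (λ k → u k * v k)

  dot-congʳ : ∀ {m} (u : Vect m) {v w : Vect m} → (∀ k → v k ≈ w k) → dot u v ≈ dot u w
  dot-congʳ u v≈w = sumFin-cong (λ k → *-congˡ (v≈w k))

  dot-zeroˡ : ∀ {m} {u : Vect m} (v : Vect m) → (∀ k → u k ≈ 0#) → dot u v ≈ 0#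
  dot-zeroˡ v u≈0 = sumFin-zero (λ k → *-zeroˡ-≈ (v k) (u≈0 k))

  dot-zeroʳ : ∀ {m} (u : Vect m) {v : Vect m} → (∀ k → v k ≈ 0#) → dot u v ≈ 0#
  dot-zeroʳ u v≈0 = sumFin-zero (λ k → *-zeroʳ-≈ (u k) (v≈0 k))

  dot-scaleʳ : ∀ {m} (u : Vect m) a (v : Vect m) → dot u (λ k → a * v k) ≈ a * dot u v
  dot-scaleʳ u a v = begin
    sumFin (λ k → u k * (a * v k)) ≈⟨ sumFin-cong (λ k → x∙yz≈y∙xz (u k) a (v k)) ⟩
    sumFin (λ k → a * (u k * v k)) ≈⟨ *-distribˡ-sumFin a (λ k → u k * v k) ⟨
    a * dot u v                    ∎

  dot-+ʳ : ∀ {m} (u v w : Vect m) → dot u (λ k → v k + w k) ≈ dot u v + dot u w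
  dot-+ʳ u v w = trans (sumFin-cong (λ k → distribˡ (u k) (v k) (w k)))
                       (sumFin-+ (λ k → u k * v k) (λ k → u k * w k))

  dot-linearˡ : ∀ {m} (u : Vect m) a (w v : Vect m) →
    dot (λ k → u k + a * w k) v ≈ dot u v + a * dot w v
  dot-linearˡ u a w v = begin
    sumFin (λ k → (u k + a * w k) * v k)
      ≈⟨ sumFin-cong (λ k → trans (distribʳ (v k) (u k) (a * w k))
                                  (+-congˡ (*-assoc a (w k) (v k)))) ⟩
    sumFin (λ k → u k * v k + a * (w k * v k))
      ≈⟨ sumFin-+ (λ k → u k * v k) (λ k → a * (w k * v k)) ⟩
    dot u v + sumFin (λ k → a * (w k * v k))
      ≈⟨ +-congˡ (*-distribˡ-sumFin a (λ k → w k * v k)) ⟨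
    dot u v + a * dot w v ∎

  dot-insertAt : ∀ {m} (u : Vect (suc m)) (y : Vect m) p a →
    dot u (insertAt y p a) ≈ u p * a + dot (u ∘ F.punchIn p) y
  dot-insertAt u y p a = begin
    dot u (insertAt y p a)
      ≈⟨ sumFin-remove (λ k → u k * insertAt y p a k) p ⟩
    u p * insertAt y p a p + dot (u ∘ F.punchIn p) (insertAt y p a ∘ F.punchIn p)
      ≈⟨ +-cong (*-congˡ (reflexive (insertAt-lookup y p a)))
                (dot-congʳ (u ∘ F.punchIn p) (reflexive ∘ insertAt-punchIn y p a)) ⟩
    u p * a + dot (u ∘ F.punchIn p) y ∎

  dot-init-last : ∀ {m} (u v : Vect (suc m)) →
    dot u v ≈ dot (u ∘ F.inject₁) (v ∘ F.inject₁) + u (F.fromℕ m) * v (F.fromℕ m)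
  dot-init-last u v = sumFin-init-last (λ k → u k * v k)

  idMat-diag : ∀ {m} (h : Fin m) → idMat h h ≈ 1#
  idMat-diag h with toℕ h ℕ.≟ toℕ h
  ... | yes _ = refl
  ... | no h≢h = ⊥-elim (h≢h ≡.refl)

  idMat-offdiag : ∀ {m} {h k : Fin m} → h ≢ k → idMat h k ≈ 0#
  idMat-offdiag {h = h} {k} h≢k with toℕ h ℕ.≟ toℕ k
  ... | yes h≡k = ⊥-elim (h≢k (F.toℕ-injective h≡k))
  ... | no _ = refl

  apply-idMat : ∀ {m} (v : Vect m) h → apply idMat v h ≈ v h
  apply-idMat {suc m} v h = begin
    dot (idMat h) v
      ≈⟨ sumFin-remove (λ k → idMat h k * v k) h ⟩
    idMat h h * v h + dot (idMat h ∘ F.punchIn h) (v ∘ F.punchIn h)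
      ≈⟨ +-cong (*-congʳ (idMat-diag h))
                (dot-zeroˡ (v ∘ F.punchIn h) (λ d → idMat-offdiag (F.punchInᵢ≢i h d ∘ ≡.sym))) ⟩
    1# * v h + 0# ≈⟨ +-identityʳ _ ⟩
    1# * v h      ≈⟨ *-identityˡ (v h) ⟩
    v h           ∎

  apply-congʳ : ∀ {m} (A : Mat m) {u v : Vect m} → (∀ k → u k ≈ v k) →
    ∀ h → apply A u h ≈ apply A v h
  apply-congʳ A u≈v h = dot-congʳ (A h) u≈v

  apply-congˡ : ∀ {m} {A C : Mat m} → A ≈M C → ∀ v h → apply A v h ≈ apply C v h
  apply-congˡ A≈C v h = sumFin-cong (λ k → *-congʳ (A≈C h k))

  apply-scale : ∀ {m} (A : Mat m) a v h → apply A (λ k → a * v k) h ≈ a * apply A v h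
  apply-scale A a v h = dot-scaleʳ (A h) a v

  apply-⊗ : ∀ {m} (A C : Mat m) v h → apply (A ⊗ C) v h ≈ apply A (apply C v) h
  apply-⊗ A C v h = begin
    sumFin (λ k → sumFin (λ j → A h j * C j k) * v k)
      ≈⟨ sumFin-cong (λ k → *-distribʳ-sumFin (v k) (λ j → A h j * C j k)) ⟩
    sumFin (λ k → sumFin (λ j → A h j * C j k * v k))
      ≈⟨ sumFin-comm (λ k j → A h j * C j k * v k) ⟩
    sumFin (λ j → sumFin (λ k → A h j * C j k * v k))
      ≈⟨ sumFin-cong (λ j → sumFin-cong (λ k → *-assoc (A h j) (C j k) (v k))) ⟩
    sumFin (λ j → sumFin (λ k → A h j * (C j k * v k)))
      ≈⟨ sumFin-cong (λ j → *-distribˡ-sumFin (A h j) (λ k → C j k * v k)) ⟨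
    sumFin (λ j → A h j * apply C v j) ∎

  apply-^-sucʳ : ∀ {m} (A : Mat m) j v h → apply (A ^ suc j) v h ≈ apply (A ^ j) (apply A v) h
  apply-^-sucʳ A ℕ.zero v h = begin
    apply (A ⊗ idMat) v h     ≈⟨ apply-⊗ A idMat v h ⟩
    apply A (apply idMat v) h ≈⟨ apply-congʳ A (apply-idMat v) h ⟩
    apply A v h               ≈⟨ apply-idMat (apply A v) h ⟨
    apply idMat (apply A v) h ∎
  apply-^-sucʳ A (suc j) v h = begin
    apply (A ⊗ (A ^ suc j)) v h           ≈⟨ apply-⊗ A (A ^ suc j) v h ⟩
    apply A (apply (A ^ suc j) v) h       ≈⟨ apply-congʳ A (apply-^-sucʳ A j v) h ⟩
    apply A (apply (A ^ j) (apply A v)) h ≈⟨ apply-⊗ A (A ^ j) (apply A v) h ⟨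
    apply (A ^ suc j) (apply A v) h       ∎

  apply-^-inverse : ∀ {m} {A C : Mat m} → (A ⊗ C) ≈M idMat →
    ∀ j v h → apply (A ^ j) (apply (C ^ j) v) h ≈ v h
  apply-^-inverse AC≈I ℕ.zero v h = trans (apply-idMat (apply idMat v) h) (apply-idMat v h)
  apply-^-inverse {A = A} {C} AC≈I (suc j) v h = begin
    apply (A ^ suc j) (apply (C ^ suc j) v) h
      ≈⟨ apply-⊗ A (A ^ j) (apply (C ^ suc j) v) h ⟩
    apply A (apply (A ^ j) (apply (C ^ suc j) v)) h
      ≈⟨ apply-congʳ A AʲCʲ⁺¹v≈Cv h ⟩
    apply A (apply C v) h ≈⟨ apply-⊗ A C v h ⟨
    apply (A ⊗ C) v h     ≈⟨ apply-congˡ AC≈I v h ⟩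
    apply idMat v h       ≈⟨ apply-idMat v h ⟩
    v h                   ∎
    where
    AʲCʲ⁺¹v≈Cv : ∀ h → apply (A ^ j) (apply (C ^ suc j) v) h ≈ apply C v h
    AʲCʲ⁺¹v≈Cv h = trans (apply-congʳ (A ^ j) (apply-^-sucʳ C j v) h)
                         (apply-^-inverse AC≈I j (apply C v) h)

  record IsCone {p m} (P : Vect m → Set p) : Set (c ⊔ ℓ ⊔ p) where
    field
      resp : ∀ {u v} → (∀ k → u k ≈ v k) → P u → P v
      scale : ∀ a {v} → P v → P (λ k → a * v k)

  transitive⇒cone-full : ∀ {p m} {A : Mat m} {P : Vect m → Set p} → TransitiveOnP A → IsCone P →
    (∀ {v} → P v → P (apply A v)) → ∀ {w v} → NonZeroV w → P w → NonZeroV v → P v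
  transitive⇒cone-full {A = A} {P} tr cone step {w} {v} w≢0 Pw v≢0 = reach (tr w v w≢0 v≢0)
    where
    open IsCone cone
    orbit : ∀ k → P (apply (A ^ k) w)
    orbit ℕ.zero = resp (λ h → sym (apply-idMat w h)) Pw
    orbit (suc k) = resp (λ h → sym (apply-⊗ A (A ^ k) w h)) (step (orbit k))
    reach : ∃[ k ] SamePoint (apply (A ^ k) w) v → P v
    reach (k , a , a≢0 , Aᵏw≈av) with inverse a a≢0
    ... | b , ab≈1 = resp (inverse-cancel ab≈1 ∘ v) (scale b (resp Aᵏw≈av (orbit k)))

  transitive-inverse : ∀ {m} {A C : Mat m} → (C ⊗ A) ≈M idMat → TransitiveOnP A → TransitiveOnP C
  transitive-inverse {A = A} {C} CA≈I tr u v u≢0 v≢0 = reverse (tr v u v≢0 u≢0)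
    where
    reverse : ∃[ k ] SamePoint (apply (A ^ k) v) u → ∃[ k ] SamePoint (apply (C ^ k) u) v
    reverse (k , a , a≢0 , Aᵏv≈au) with inverse a a≢0
    ... | b , ab≈1 = k , b , inverse-nonzero ab≈1 , λ h → begin
      apply (C ^ k) u h                     ≈⟨ inverse-cancel ab≈1 _ ⟨
      b * (a * apply (C ^ k) u h)           ≈⟨ *-congˡ (apply-scale (C ^ k) a u h) ⟨
      b * apply (C ^ k) (λ h′ → a * u h′) h ≈⟨ *-congˡ (apply-congʳ (C ^ k) Aᵏv≈au h) ⟨
      b * apply (C ^ k) (apply (A ^ k) v) h ≈⟨ *-congˡ (apply-^-inverse CA≈I k v h) ⟩
      b * v h                               ∎

  module GaussianStep {k} (g : Vect (suc k)) (p : Fin (suc k)) {ι} (gι≈1 : g p * ι ≈ 1#) where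
    reduce : Vect (suc k) → Vect k
    reduce u d = u (F.punchIn p d) + - (u p * ι) * g (F.punchIn p d)

    lift : Vect k → Vect (suc k)
    lift y = insertAt y p (- (ι * dot (g ∘ F.punchIn p) y))

    dot-lift : ∀ u y → dot u (lift y) ≈ dot (reduce u) y
    dot-lift u y = begin
      dot u (lift y)                            ≈⟨ dot-insertAt u y p _ ⟩
      u p * - (ι * S) + dot (u ∘ F.punchIn p) y ≈⟨ +-comm _ _ ⟩
      dot (u ∘ F.punchIn p) y + u p * - (ι * S) ≈⟨ +-congˡ sign-shuffle ⟨
      dot (u ∘ F.punchIn p) y + - (u p * ι) * S
        ≈⟨ dot-linearˡ (u ∘ F.punchIn p) (- (u p * ι)) (g ∘ F.punchIn p) y ⟨
      dot (reduce u) y ∎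
      where
      S : Carrier
      S = dot (g ∘ F.punchIn p) y
      sign-shuffle : - (u p * ι) * S ≈ u p * - (ι * S)
      sign-shuffle = begin
        - (u p * ι) * S   ≈⟨ -‿distribˡ-* (u p * ι) S ⟨
        - (u p * ι * S)   ≈⟨ -‿cong (*-assoc (u p) ι S) ⟩
        - (u p * (ι * S)) ≈⟨ -‿distribʳ-* (u p) (ι * S) ⟩
        u p * - (ι * S)   ∎

    reduce-pivot : ∀ d → reduce g d ≈ 0#
    reduce-pivot d = begin
      g′ + - (g p * ι) * g′ ≈⟨ +-congˡ (*-congʳ (-‿cong gι≈1)) ⟩
      g′ + - 1# * g′        ≈⟨ +-congˡ (-1*x≈-x g′) ⟩
      g′ + - g′             ≈⟨ -‿inverseʳ g′ ⟩
      0#                    ∎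
      where
      g′ : Carrier
      g′ = g (F.punchIn p d)

    lift-nonzero : ∀ {y} → NonZeroV y → NonZeroV (lift y)
    lift-nonzero {y} y≢0 lift≈0 =
      y≢0 λ d → trans (reflexive (≡.sym (insertAt-punchIn y p _ d))) (lift≈0 (F.punchIn p d))

  homogeneous-nonzero-solution : ∀ {m k} → m ℕ.< k → (f : Fin m → Vect k) →
    DoubleNegation (∃ λ w → NonZeroV w × ∀ r → dot (f r) w ≈ 0#)
  homogeneous-nonzero-solution {ℕ.zero} {suc k} _ f ¬sol =
    ¬sol ((λ _ → 1#) , (λ 1≈0 → 1≉0 (1≈0 F.zero)) , λ ())
  homogeneous-nonzero-solution {suc m} {suc k} (ℕ.s≤s m<k) f ¬sol = ¬¬-excluded-middle λ where
      (yes g≈0) → homogeneous-nonzero-solution (ℕ.m<n⇒m<1+n m<k) (f ∘ F.suc) λ (w , w≢0 , fw≈0) →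
        ¬sol (w , w≢0 , λ { F.zero → dot-zeroˡ w g≈0 ; (F.suc r) → fw≈0 r })
      (no g≢0) → nonzero⇒¬¬pivot g≢0 λ (p , gp≢0) → eliminate p (inverse (g p) gp≢0)
    where
    g : Vect (suc k)
    g = f F.zero
    eliminate : ∀ p → ∃ (λ ι → g p * ι ≈ 1#) → ⊥
    eliminate p (ι , gι≈1) =
      homogeneous-nonzero-solution m<k (reduce ∘ f ∘ F.suc) λ (y , y≢0 , fy≈0) →
        ¬sol (lift y , lift-nonzero y≢0 , λ
          { F.zero → trans (dot-lift g y) (dot-zeroˡ y reduce-pivot)
          ; (F.suc r) → trans (dot-lift (f (F.suc r)) y) (fy≈0 r) })
      where open GaussianStep g p gι≈1

  monomial : ∀ {n} → Vec ℕ n → Vect n → Carrier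
  monomial [] x = 1#
  monomial (e ∷ es) x = x F.zero ^ᶜ e * monomial es (x ∘ F.suc)

  evalTerm : ∀ {n} → Carrier × Vec ℕ n → Vect n → Carrier
  evalTerm (a , e) x = a * monomial e x

  eval : ∀ {n} → Poly n → Vect n → Carrier
  eval L.[] x = 0#
  eval (t L.∷ p) x = evalTerm t x + eval p x

  monomial-addExp : ∀ {n} (e e′ : Vec ℕ n) x →
    monomial (addExp e e′) x ≈ monomial e x * monomial e′ x
  monomial-addExp [] [] x = sym (*-identityˡ 1#)
  monomial-addExp (a ∷ e) (b ∷ e′) x = begin
    x₀ ^ᶜ (a ℕ.+ b) * monomial (addExp e e′) x₊
      ≈⟨ *-cong (^ᶜ-homo-* x₀ a b) (monomial-addExp e e′ x₊) ⟩
    x₀ ^ᶜ a * x₀ ^ᶜ b * (monomial e x₊ * monomial e′ x₊)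
      ≈⟨ interchange _ _ _ _ ⟩
    x₀ ^ᶜ a * monomial e x₊ * (x₀ ^ᶜ b * monomial e′ x₊) ∎
    where
    x₀ : Carrier
    x₀ = x F.zero
    x₊ : Vect _
    x₊ = x ∘ F.suc

  monomial-0 : ∀ {n} (x : Vect n) → monomial (V.replicate n 0) x ≈ 1#
  monomial-0 {ℕ.zero} x = refl
  monomial-0 {suc n} x = trans (*-identityˡ _) (monomial-0 (x ∘ F.suc))

  monomial-unitExp : ∀ {n} (k : Fin n) (x : Vect n) → monomial (unitExp k) x ≈ x k
  monomial-unitExp F.zero x =
    trans (*-cong (*-identityʳ (x F.zero)) (monomial-0 (x ∘ F.suc))) (*-identityʳ _)
  monomial-unitExp (F.suc k) x = trans (*-identityˡ _) (monomial-unitExp k (x ∘ F.suc))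

  eval-++ : ∀ {n} (p r : Poly n) x → eval (p +P r) x ≈ eval p x + eval r x
  eval-++ L.[] r x = sym (+-identityˡ _)
  eval-++ (t L.∷ p) r x = trans (+-congˡ (eval-++ p r x)) (sym (+-assoc _ _ _))

  eval-*P : ∀ {n} (p r : Poly n) x → eval (p *P r) x ≈ eval p x * eval r x
  eval-*P L.[] r x = sym (zeroˡ _)
  eval-*P ((a , e) L.∷ p) r x = begin
    eval (L.map (times (a , e)) r L.++ (p *P r)) x
      ≈⟨ eval-++ (L.map (times (a , e)) r) (p *P r) x ⟩
    eval (L.map (times (a , e)) r) x + eval (p *P r) x
      ≈⟨ +-cong (eval-map-times r) (eval-*P p r x) ⟩
    evalTerm (a , e) x * eval r x + eval p x * eval r x
      ≈⟨ distribʳ _ _ _ ⟨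
    eval ((a , e) L.∷ p) x * eval r x ∎
    where
    times : Carrier × Vec ℕ _ → Carrier × Vec ℕ _ → Carrier × Vec ℕ _
    times (a , e) (b , e′) = a * b , addExp e e′
    eval-map-times : ∀ r → eval (L.map (times (a , e)) r) x ≈ evalTerm (a , e) x * eval r x
    eval-map-times L.[] = sym (zeroʳ _)
    eval-map-times ((b , e′) L.∷ r) = begin
      a * b * monomial (addExp e e′) x + eval (L.map (times (a , e)) r) x
        ≈⟨ +-cong (trans (*-congˡ (monomial-addExp e e′ x)) (interchange a b _ _))
                  (eval-map-times r) ⟩
      evalTerm (a , e) x * evalTerm (b , e′) x + evalTerm (a , e) x * eval r x
        ≈⟨ distribˡ _ _ _ ⟨
      evalTerm (a , e) x * eval ((b , e′) L.∷ r) x ∎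

  eval-sumP : ∀ {n k} (f : Fin k → Poly n) x → eval (sumP f) x ≈ sumFin (λ j → eval (f j) x)
  eval-sumP {k = ℕ.zero} f x = refl
  eval-sumP {k = suc k} f x =
    trans (eval-++ (f F.zero) _ x) (+-congˡ (eval-sumP (f ∘ F.suc) x))

  eval-tabulate : ∀ {n m} (t : Fin m → Carrier × Vec ℕ n) x →
    eval (L.tabulate t) x ≈ sumFin (λ k → evalTerm (t k) x)
  eval-tabulate {m = ℕ.zero} t x = refl
  eval-tabulate {m = suc m} t x = +-congˡ (eval-tabulate (t ∘ F.suc) x)

  module _ {n : ℕ} where
    private
      _≟ₑ_ : (e e′ : Vec ℕ n) → Dec (e ≡ e′)
      _≟ₑ_ = ≡-dec ℕ._≟_

      single : Carrier → Vec ℕ n → Poly n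
      single a e = (a , e) L.∷ L.[]

    expand : L.List (Vec ℕ n) → (Vec ℕ n → Carrier) → Vect n → Carrier
    expand L.[] φ x = 0#
    expand (e L.∷ E) φ x = φ e * monomial e x + expand E φ x

    expand-cong : ∀ E {φ ψ} x → (∀ e → φ e ≈ ψ e) → expand E φ x ≈ expand E ψ x
    expand-cong L.[] x φ≈ψ = refl
    expand-cong (e L.∷ E) x φ≈ψ = +-cong (*-congʳ (φ≈ψ e)) (expand-cong E x φ≈ψ)

    expand-+ : ∀ E φ ψ x → expand E (λ e → φ e + ψ e) x ≈ expand E φ x + expand E ψ x
    expand-+ L.[] φ ψ x = sym (+-identityʳ 0#)
    expand-+ (e L.∷ E) φ ψ x =
      trans (+-cong (distribʳ _ _ _) (expand-+ E φ ψ x)) (+-interchange _ _ _ _)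

    expand-zero : ∀ E x → expand E (coeff L.[]) x ≈ 0#
    expand-zero L.[] x = refl
    expand-zero (e L.∷ E) x = trans (+-cong (zeroˡ _) (expand-zero E x)) (+-identityʳ 0#)

    coeff-∷ : ∀ a e′ p e → coeff ((a , e′) L.∷ p) e ≈ coeff (single a e′) e + coeff p e
    coeff-∷ a e′ p e with ≡-dec ℕ._≟_ e′ e
    ... | yes _ = +-congʳ (sym (+-identityʳ a))
    ... | no _ = sym (+-identityˡ _)

    coeff-single-≢ : ∀ a {e′ e} → e′ ≢ e → coeff (single a e′) e ≈ 0#
    coeff-single-≢ a {e′} {e} e′≢e with ≡-dec ℕ._≟_ e′ e
    ... | yes e′≡e = ⊥-elim (e′≢e e′≡e)
    ... | no _ = refl

    coeff-single-≡ : ∀ a e → coeff (single a e) e ≈ a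
    coeff-single-≡ a e with ≡-dec ℕ._≟_ e e
    ... | yes _ = +-identityʳ a
    ... | no e≢e = ⊥-elim (e≢e ≡.refl)

    expand-single-∉ : ∀ a {e′} E x → All (e′ ≢_) E → expand E (coeff (single a e′)) x ≈ 0#
    expand-single-∉ a L.[] x All.[] = refl
    expand-single-∉ a (e L.∷ E) x (e′≢e All.∷ e′∉E) =
      trans (+-cong (*-zeroˡ-≈ _ (coeff-single-≢ a e′≢e)) (expand-single-∉ a E x e′∉E))
            (+-identityʳ 0#)

    expand-single : ∀ a {e′ E} x → e′ ∈ E → Unique E →
      expand E (coeff (single a e′)) x ≈ evalTerm (a , e′) x
    expand-single a {e′} x (here ≡.refl) (e′∉E ∷ _) =
      trans (+-cong (*-congʳ (coeff-single-≡ a e′)) (expand-single-∉ a _ x e′∉E))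
            (+-identityʳ _)
    expand-single a x (there e′∈E) (e∉E ∷ E!) =
      trans (+-cong (*-zeroˡ-≈ _ (coeff-single-≢ a (All.lookup e∉E e′∈E ∘ ≡.sym)))
                    (expand-single a x e′∈E E!))
            (+-identityˡ _)

    exponents : Poly n → L.List (Vec ℕ n)
    exponents = L.map proj₂

    eval≈expand : ∀ (p : Poly n) {E} x → (∀ {e} → e ∈ exponents p → e ∈ E) → Unique E →
      eval p x ≈ expand E (coeff p) x
    eval≈expand L.[] {E} x _ _ = sym (expand-zero E x)
    eval≈expand ((a , e′) L.∷ p) {E} x ⊆E E! = begin
      evalTerm (a , e′) x + eval p x
        ≈⟨ +-cong (sym (expand-single a x (⊆E (here ≡.refl)) E!)) (eval≈expand p x (⊆E ∘ there) E!) ⟩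
      expand E (coeff (single a e′)) x + expand E (coeff p) x
        ≈⟨ expand-+ E _ _ x ⟨
      expand E (λ e → coeff (single a e′) e + coeff p e) x
        ≈⟨ expand-cong E x (coeff-∷ a e′ p) ⟨
      expand E (coeff ((a , e′) L.∷ p)) x ∎

    -- Both sides are expanded over one duplicate-free list of the exponents of p and r.
    eval-resp-≈P : ∀ (p r : Poly n) → p ≈P r → ∀ x → eval p x ≈ eval r x
    eval-resp-≈P p r p≈r x = begin
      eval p x             ≈⟨ eval≈expand p x (∈-deduplicate⁺ _≟ₑ_ ∘ ∈-++⁺ˡ) E! ⟩
      expand E (coeff p) x ≈⟨ expand-cong E x p≈r ⟩
      expand E (coeff r) x ≈⟨ eval≈expand r x (∈-deduplicate⁺ _≟ₑ_ ∘ ∈-++⁺ʳ (exponents p)) E! ⟨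
      eval r x             ∎
      where
      E : L.List (Vec ℕ n)
      E = L.deduplicate _≟ₑ_ (exponents p L.++ exponents r)
      E! : Unique E
      E! = deduplicate-! _≟ₑ_ (exponents p L.++ exponents r)

  InIdeal⇒vanishes : ∀ {n k} (p : Poly n) (g : Fin k → Poly n) → InIdeal p g →
    ∀ x → (∀ j → eval (g j) x ≈ 0#) → eval p x ≈ 0#
  InIdeal⇒vanishes p g (a , p≈∑ag) x g≈0 = begin
    eval p x                           ≈⟨ eval-resp-≈P p (sumP (λ j → a j *P g j)) p≈∑ag x ⟩
    eval (sumP (λ j → a j *P g j)) x   ≈⟨ eval-sumP (λ j → a j *P g j) x ⟩
    sumFin (λ j → eval (a j *P g j) x) ≈⟨ sumFin-zero ag≈0 ⟩
    0#                                 ∎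
    where
    ag≈0 : ∀ j → eval (a j *P g j) x ≈ 0#
    ag≈0 j = trans (eval-*P (a j) (g j) x) (*-zeroʳ-≈ _ (g≈0 j))

  eval-bPoly : ∀ {n} (A : Mat (suc n)) i x →
    eval (bPoly A i) x ≈ dot ((A ^ i) (F.fromℕ n) ∘ F.inject₁) x + (A ^ i) (F.fromℕ n) (F.fromℕ n)
  eval-bPoly {n} A i x = begin
    row ω * monomial (V.replicate n 0) x + eval (L.map linearTerm (L.allFin n)) x
      ≡⟨ ≡.cong (λ q → row ω * monomial (V.replicate n 0) x + eval q x)
                (map-tabulate (λ k → k) linearTerm) ⟩
    row ω * monomial (V.replicate n 0) x + eval (L.tabulate linearTerm) x
      ≈⟨ +-cong (trans (*-congˡ (monomial-0 x)) (*-identityʳ _)) (eval-tabulate linearTerm x) ⟩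
    row ω + sumFin (λ k → row (F.inject₁ k) * monomial (unitExp k) x)
      ≈⟨ +-comm _ _ ⟩
    sumFin (λ k → row (F.inject₁ k) * monomial (unitExp k) x) + row ω
      ≈⟨ +-congʳ (sumFin-cong (λ k → *-congˡ (monomial-unitExp k x))) ⟩
    dot (row ∘ F.inject₁) x + row ω ∎
    where
    ω : Fin (suc n)
    ω = F.fromℕ n
    row : Vect (suc n)
    row = (A ^ i) ω
    linearTerm : Fin n → Carrier × Vec ℕ n
    linearTerm k = row (F.inject₁ k) , unitExp k

  eval-bPoly-dehomogenise : ∀ {n} (A : Mat (suc n)) i (v : Vect (suc n)) {ι} →
    v (F.fromℕ n) * ι ≈ 1# →
    eval (bPoly A i) (λ k → ι * v (F.inject₁ k)) ≈ ι * apply (A ^ i) v (F.fromℕ n)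
  eval-bPoly-dehomogenise {n} A i v {ι} vι≈1 = begin
    eval (bPoly A i) (ιv ∘ F.inject₁)                      ≈⟨ eval-bPoly A i (ιv ∘ F.inject₁) ⟩
    dot (row ∘ F.inject₁) (ιv ∘ F.inject₁) + row ω         ≈⟨ +-congˡ rowιv≈row ⟨
    dot (row ∘ F.inject₁) (ιv ∘ F.inject₁) + row ω * ιv ω ≈⟨ dot-init-last row ιv ⟨
    dot row ιv                                             ≈⟨ dot-scaleʳ row ι v ⟩
    ι * apply (A ^ i) v ω                                  ∎
    where
    ω : Fin (suc n)
    ω = F.fromℕ n
    row : Vect (suc n)
    row = (A ^ i) ω
    ιv : Vect (suc n)
    ιv k = ι * v k
    rowιv≈row : row ω * ιv ω ≈ row ω
    rowιv≈row = trans (*-congˡ (trans (*-comm ι (v ω)) vι≈1)) (*-identityʳ (row ω))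

  module LastRow {n} (M B : Mat (suc n)) (MB≈I : (M ⊗ B) ≈M idMat) where
    ω : Fin (suc n)
    ω = F.fromℕ n

    form : ℕ → Vect (suc n) → Carrier
    form j v = apply (M ^ j) v ω

    form-M : ∀ j v → form j (apply M v) ≈ form (suc j) v
    form-M j v = sym (apply-^-sucʳ M j v ω)

    form-B : ∀ j v → form (suc j) (apply B v) ≈ form j v
    form-B j v = trans (apply-^-sucʳ M j (apply B v) ω) (apply-congʳ (M ^ j) MBv≈v ω)
      where
      MBv≈v : ∀ h → apply M (apply B v) h ≈ v h
      MBv≈v h = trans (sym (apply-⊗ M B v h)) (trans (apply-congˡ MB≈I v h) (apply-idMat v h))

    form-+ : ∀ j u v → form j (λ k → u k + v k) ≈ form j u + form j v
    form-+ j u v = dot-+ʳ ((M ^ j) ω) u v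

    ideal⇒form-vanishes : ∀ {i′} →
      InIdeal (bPoly M (suc i′)) (λ (j : Fin i′) → bPoly M (suc (toℕ j))) →
      ∀ v → ¬ v ω ≈ 0# → (∀ (j : Fin i′) → form (suc (toℕ j)) v ≈ 0#) → form (suc i′) v ≈ 0#
    ideal⇒form-vanishes {i′} I v vω≢0 v∈ker with inverse (v ω) vω≢0
    ... | ι , vι≈1 = begin
      form (suc i′) v                 ≈⟨ inverse-cancel (trans (*-comm ι (v ω)) vι≈1) _ ⟨
      v ω * (ι * form (suc i′) v)     ≈⟨ *-congˡ (dehomogenise (suc i′)) ⟨
      v ω * eval (bPoly M (suc i′)) x ≈⟨ *-zeroʳ-≈ (v ω) b⁽ⁱ⁾x≈0 ⟩
      0#                              ∎
      where
      x : Vect n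
      x k = ι * v (F.inject₁ k)
      dehomogenise : ∀ j → eval (bPoly M j) x ≈ ι * form j v
      dehomogenise j = eval-bPoly-dehomogenise M j v vι≈1
      b⁽ⁱ⁾x≈0 : eval (bPoly M (suc i′)) x ≈ 0#
      b⁽ⁱ⁾x≈0 = InIdeal⇒vanishes (bPoly M (suc i′)) (λ (j : Fin i′) → bPoly M (suc (toℕ j))) I x
        λ j → trans (dehomogenise (suc (toℕ j))) (*-zeroʳ-≈ ι (v∈ker j))

  module NotInIdeal {n} {M B : Mat (suc n)} (MB≈I : (M ⊗ B) ≈M idMat) (BM≈I : (B ⊗ M) ≈M idMat)
           (tr : TransitiveOnP M) {i′} (i′<n+1 : i′ ℕ.< suc n)
           (I : InIdeal (bPoly M (suc i′)) (λ (j : Fin i′) → bPoly M (suc (toℕ j)))) where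
    open LastRow M B MB≈I

    -- A record rather than a function type, so that v can be inferred from Kernel v.
    record Kernel (v : Vect (suc n)) : Set ℓ where
      constructor kernel
      field vanishes : ∀ j → j ℕ.< i′ → DoubleNegation (form (suc j) v ≈ 0#)
    open Kernel

    kernel-cone : IsCone Kernel
    kernel-cone = record
      { resp = λ u≈v Ku → kernel λ j j<i′ →
          ¬¬-map (trans (apply-congʳ (M ^ suc j) (sym ∘ u≈v) ω)) (vanishes Ku j j<i′)
      ; scale = λ a {v} Kv → kernel λ j j<i′ →
          ¬¬-map (λ z → trans (apply-scale (M ^ suc j) a v ω) (*-zeroʳ-≈ a z)) (vanishes Kv j j<i′)
      }

    kernel-+ : ∀ {u v} → Kernel u → Kernel v → Kernel (λ k → u k + v k)
    kernel-+ {u} {v} Ku Kv = kernel λ j j<i′ ¬z →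
      vanishes Ku j j<i′ λ zu → vanishes Kv j j<i′ λ zv →
        ¬z (trans (form-+ (suc j) u v) (trans (+-cong zu zv) (+-identityʳ 0#)))

    affine-kernel⇒form-vanishes : ∀ {v} → Kernel v → ¬ v ω ≈ 0# →
      DoubleNegation (form (suc i′) v ≈ 0#)
    affine-kernel⇒form-vanishes {v} Kv vω≢0 =
      ¬¬-map (ideal⇒form-vanishes I v vω≢0) (¬¬-∀Fin (λ j → vanishes Kv (toℕ j) (F.toℕ<n j)))

    e : Vect (suc n)
    e h = idMat h ω

    e-nonzero : NonZeroV e
    e-nonzero e≈0 = 1≉0 (trans (sym (idMat-diag ω)) (e≈0 ω))

    module AffineKernelVector {u} (Ku : Kernel u) (uω≢0 : ¬ u ω ≈ 0#) where
      kernel⇒form-vanishes : ∀ {v} → Kernel v → DoubleNegation (form (suc i′) v ≈ 0#)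
      kernel⇒form-vanishes {v} Kv ¬z = ¬¬-excluded-middle λ
        { (no vω≢0) → affine-kernel⇒form-vanishes Kv vω≢0 ¬z
        ; (yes vω≈0) → vertical vω≈0 ¬z }
        where
        vertical : v ω ≈ 0# → DoubleNegation (form (suc i′) v ≈ 0#)
        vertical vω≈0 ¬z =
          affine-kernel⇒form-vanishes (kernel-+ Kv Ku) v+uω≢0 λ zvu →
          affine-kernel⇒form-vanishes Ku uω≢0 λ zu → ¬z (begin
            form (suc i′) v                   ≈⟨ +-identityʳ _ ⟨
            form (suc i′) v + 0#              ≈⟨ +-congˡ zu ⟨
            form (suc i′) v + form (suc i′) u ≈⟨ form-+ (suc i′) v u ⟨
            form (suc i′) (λ k → v k + u k)   ≈⟨ zvu ⟩
            0#                                ∎)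
          where
          v+uω≢0 : ¬ v ω + u ω ≈ 0#
          v+uω≢0 z = uω≢0 (trans (sym (trans (+-congʳ vω≈0) (+-identityˡ (u ω)))) z)

      kernel-M-invariant : ∀ {v} → Kernel v → Kernel (apply M v)
      kernel-M-invariant {v} Kv = kernel step
        where
        step : ∀ j → j ℕ.< i′ → DoubleNegation (form (suc j) (apply M v) ≈ 0#)
        step j j<i′ with ℕ.m≤n⇒m<n∨m≡n j<i′
        ... | inj₁ j+1<i′ = ¬¬-map (trans (form-M (suc j) v)) (vanishes Kv (suc j) j+1<i′)
        ... | inj₂ ≡.refl = ¬¬-map (trans (form-M (suc j) v)) (kernel⇒form-vanishes Kv)

      v₀ : Vect (suc n)
      v₀ = apply (B ^ suc i′) e

      form-v₀ : form (suc i′) v₀ ≈ 1#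
      form-v₀ = trans (apply-^-inverse MB≈I (suc i′) e ω) (idMat-diag ω)

      absurd : ⊥
      absurd = kernel⇒form-vanishes Kv₀ λ z → 1≉0 (trans (sym form-v₀) z)
        where
        Kv₀ : Kernel v₀
        Kv₀ = transitive⇒cone-full tr kernel-cone kernel-M-invariant (λ u≈0 → uω≢0 (u≈0 ω)) Ku
                (λ v₀≈0 → 1≉0 (trans (sym form-v₀) (dot-zeroʳ ((M ^ suc i′) ω) v₀≈0)))

    vertical-kernel-absurd : (∀ {u} → Kernel u → DoubleNegation (u ω ≈ 0#)) →
      ∀ {w} → NonZeroV w → Kernel w → ⊥
    vertical-kernel-absurd vertical w≢0 Kw =
      vertical Ke λ eω≈0 → 1≉0 (trans (sym (idMat-diag ω)) eω≈0)
      where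
      kernel-B-invariant : ∀ {v} → Kernel v → Kernel (apply B v)
      kernel-B-invariant {v} Kv = kernel step
        where
        step : ∀ j → j ℕ.< i′ → DoubleNegation (form (suc j) (apply B v) ≈ 0#)
        step ℕ.zero _ =
          ¬¬-map (λ vω≈0 → trans (form-B 0 v) (trans (apply-idMat v ω) vω≈0)) (vertical Kv)
        step (suc j) j+1<i′ =
          ¬¬-map (trans (form-B (suc j) v)) (vanishes Kv j (ℕ.<-trans (ℕ.n<1+n j) j+1<i′))
      Ke : Kernel e
      Ke = transitive⇒cone-full (transitive-inverse {A = M} {C = B} BM≈I tr) kernel-cone
             kernel-B-invariant w≢0 Kw e-nonzero

    absurd : ⊥
    absurd = ¬¬-excluded-middle {A = ∃ λ u → Kernel u × ¬ u ω ≈ 0#} λ where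
      (yes (u , Ku , uω≢0)) → AffineKernelVector.absurd Ku uω≢0
      (no ¬affine) →
        homogeneous-nonzero-solution i′<n+1 (λ r → (M ^ suc (toℕ r)) ω) λ (w , w≢0 , Mw≈0) →
          vertical-kernel-absurd (λ {u} Ku uω≢0 → ¬affine (u , Ku , uω≢0)) w≢0 (kernel λ j j<i′ →
            contradiction (≡.subst (λ t → form (suc t) w ≈ 0#) (F.toℕ-fromℕ< j<i′)
                                   (Mw≈0 (F.fromℕ< j<i′))))

  bPoly-∉-ideal-of-previous : ∀ {n} (M : Mat (suc n)) → Invertible M → TransitiveOnP M →
    ∀ i′ → i′ ℕ.< suc n → ¬ InIdeal (bPoly M (suc i′)) (λ (j : Fin i′) → bPoly M (suc (toℕ j)))
  bPoly-∉-ideal-of-previous M (B , MB≈I , BM≈I) tr i′ i′<n+1 =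
    NotInIdeal.absurd {B = B} MB≈I BM≈I tr i′<n+1

mainTheorem4 : ∀ {c ℓ} (K : FiniteField c ℓ) → let open FF K in
    (n : ℕ) → 1 ≤ n → (M : Mat (suc n)) → Invertible M → TransitiveOnP M →
    ¬ (bPoly M 1 ≈P zeroP)
    × (∀ (i : ℕ) → 2 ≤ i → i ≤ suc n →
    ¬ InIdeal (bPoly M i) (λ (j : Fin (i ∸ 1)) → bPoly M (suc (toℕ j))))
mainTheorem4 K n _ M M-inv tr = b⁽¹⁾≉0 , b⁽ⁱ⁾∉ideal
  where
  open FF K
  open Development K using (bPoly-∉-ideal-of-previous)
  -- b⁽¹⁾ ≈ 0 says that b⁽¹⁾ lies in the ideal generated by no polynomials.
  b⁽¹⁾≉0 : ¬ (bPoly M 1 ≈P zeroP)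
  b⁽¹⁾≉0 b⁽¹⁾≈0 = bPoly-∉-ideal-of-previous M M-inv tr 0 (ℕ.s≤s ℕ.z≤n) ((λ ()) , b⁽¹⁾≈0)
  b⁽ⁱ⁾∉ideal : ∀ i → 2 ≤ i → i ≤ suc n →
    ¬ InIdeal (bPoly M i) (λ (j : Fin (i ∸ 1)) → bPoly M (suc (toℕ j)))
  b⁽ⁱ⁾∉ideal (suc i′) _ i≤n+1 = bPoly-∉-ideal-of-previous M M-inv tr i′ i≤n+1
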